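{- Let $w$ be an infinite recurrent binary word generated by a morphism $\phi$. If $\det A_\phi=\pm1$, then $w$ satisfies the WELLDOC property.
   Context: Alphabet $\Sigma=\{0,1\}$; a binary word by convention contains both letters. A morphism is nonerasing; $w$ is generated by $\phi$ if $\phi(a)=as$ with $s$ nonempty and $w=\lim_n\phi^n(a)$. $A_\phi$ is the $2\times2$ matrix with entry $|\phi(i)|_j$ in row $j$, column $i$. Parikh vector $V_u=(|u|_0,|u|_1)$. For a factor $u$ of $w$ occurring at positions $a_0<a_1<\dots$, $X_u=\{V_{w[0,a_i)}\}$, $X_{u,m}$ its reduction mod $m$; WELLDOC means $X_{u,m}=(\mathbb{Z}/m\mathbb{Z})^2$ for all $m\ge1$ and all factors $u$. Recurrent: every factor occurs infinitely often. -}

module Defs where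

open import Data.Nat using (ℕ; zero; suc; _+_; _*_; _<_; _≥_; NonZero; _%_)
open import Data.Fin using (Fin; zero; suc)
open import Data.List using (List; []; _∷_; concatMap; length)
open import Data.Integer as ℤ using (ℤ; +_)
open import Data.Product using (Σ; ∃; ∃-syntax; _×_; _,_)
open import Relation.Binary.PropositionalEquality using (_≡_; _≢_)
open import Relation.Nullary using (¬_; yes; no)
open import Data.Fin using (_≟_)
open import Data.Sum using (_⊎_)

Letter : Set
Letter = Fin 2

l0 l1 : Letter
l0 = zero
l1 = suc zero

Morphism : Set
Morphism = Letter → List Letter

Nonerasing : Morphism → Set
Nonerasing φ = ∀ a → φ a ≢ []

apply : Morphism → List Letter → List Letter
apply φ = concatMap φ

iter : Morphism → ℕ → List Letter → List Letter
iter φ zero    u = u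
iter φ (suc n) u = apply φ (iter φ n u)

InfWord : Set
InfWord = ℕ → Letter

factorAt : InfWord → ℕ → ℕ → List Letter
factorAt w i zero    = []
factorAt w i (suc n) = w i ∷ factorAt w (suc i) n

prefix : InfWord → ℕ → List Letter
prefix w p = factorAt w 0 p

count : Letter → List Letter → ℕ
count a []      = 0
count a (b ∷ u) with a ≟ b
... | yes _ = suc (count a u)
... | no  _ = count a u

-- w is generated by φ: φ(a) = a s with s nonempty and w = lim φ^n(a),
-- i.e. every φ^n(a) is a prefix of w (their lengths grow unboundedly).
GeneratedBy : Morphism → InfWord → Set
GeneratedBy φ w =
  ∃[ a ] ∃[ s ] (φ a ≡ a ∷ s) × (s ≢ []) ×
    (∀ n → prefix w (length (iter φ n (a ∷ []))) ≡ iter φ n (a ∷ []))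

Binary : InfWord → Set
Binary w = (∃[ i ] w i ≡ l0) × (∃[ j ] w j ≡ l1)

IsFactor : List Letter → InfWord → Set
IsFactor u w = ∃[ i ] factorAt w i (length u) ≡ u

OccursAt : List Letter → InfWord → ℕ → Set
OccursAt u w p = factorAt w p (length u) ≡ u

Recurrent : InfWord → Set
Recurrent w = ∀ u → IsFactor u w → ∀ N → ∃[ p ] (p ≥ N) × OccursAt u w p

-- det A_φ where (A_φ)_{j i} = |φ(i)|_j.
detA : Morphism → ℤ
detA φ = (+ (count l0 (φ l0) * count l1 (φ l1))) ℤ.- (+ (count l0 (φ l1) * count l1 (φ l0)))

-- WELLDOC: for every m ≥ 1 and every factor u, the set X_{u,m} of Parikh
-- vectors of prefixes w[0,a_i) preceding occurrences a_i of u, reduced mod m,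
-- is all of (ℤ/mℤ)²: every residue pair (x mod m, y mod m) is attained.
WELLDOC : InfWord → Set
WELLDOC w = ∀ (m : ℕ) .{{_ : NonZero m}} → ∀ u → IsFactor u w → ∀ (x y : ℕ) →
  ∃[ p ] OccursAt u w p ×
    (count l0 (prefix w p) % m ≡ x % m) × (count l1 (prefix w p) % m ≡ y % m)

{-# OPTIONS --safe #-}
-- Fix m, let a be the letter with w = φ^ω(a), and b the other letter. As det A_φ = ±1,
-- A_φ is invertible modulo m, so A_φ^(N+1) ≡ 1 (mod m) for some N. Call a vector z
-- shiftable if every prefix P of w also occurs right after some prefix y of w with
-- Parikh vector ≡ z. Shiftable vectors are closed under addition, hence (mod m) under
-- subtraction. If xa is a prefix, then so is φ^n(x)φ^n(a) for n = k(N+1); its first part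
-- has Parikh vector ≡ V(x), and φ^n(a) begins with a given prefix P once n ≥ |P|; so V(x)
-- is shiftable. Writing φ(b) = y₁ a y₂, the same argument makes V(x) + A_φ^N V(y₁)
-- shiftable whenever xb is a prefix. Comparing the two letters of occurrences of ab, of ba
-- and of a square aa or bb then shows that both unit vectors are shiftable, hence every
-- vector is, which is WELLDOC. These factors exist: ab because w is binary and starts
-- with a, ba by recurrence, and a square because otherwise w begins with an alternating
-- word containing φ(abab); then φ(a) and φ(abab) alternate as well, their Parikh vectors
-- are balanced, and this forces det A_φ ∉ {±1}. Recurrence also puts a into φ(b): otherwise
-- det A_φ = ±1 gives |φ(a)|_a = 1, so each φ^n(a) contains a single a.

module Submission where

open import Defs
open import Data.Integer using (+_; -_)
open import Data.Sum using (_⊎_)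
open import Relation.Binary.PropositionalEquality using (_≡_)

open import Data.Nat using (ℕ; zero; suc; pred; _+_; _*_; _∸_; _≤_; _<_; z≤n; s≤s; NonZero; _%_)
import Data.Nat.Properties as ℕ
open import Data.Nat.DivMod using (_mod_; [m+kn]%n≡m%n; %-distribˡ-+; %-distribˡ-*)
open import Data.Nat.Tactic.RingSolver using (solve-∀)
open import Data.Fin using (Fin; zero; suc; toℕ; funToFin; finToFun; _≟_)
import Data.Fin.Properties as Fin
open import Data.List using (List; []; _∷_; _++_; length; iterate; concat; map)
import Data.List.Properties as List
open import Data.Product using (∃-syntax; _×_; _,_; proj₁; proj₂)
open import Data.Sum as Sum using (inj₁; inj₂)
open import Data.Empty using (⊥-elim)
open import Function using (_∘_)
open import Relation.Nullary using (¬_; yes; no)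
open import Relation.Binary.Definitions using (DecidableEquality)
open import Relation.Binary.Bundles using (Setoid)
import Relation.Binary.Reasoning.Setoid
open import Relation.Binary.PropositionalEquality
  using (refl; sym; trans; cong; cong₂; subst; subst₂; _≢_; _≗_; module ≡-Reasoning)
import Data.Integer as ℤ
import Data.Integer.Properties as ℤ

other : Letter → Letter
other zero       = suc zero
other (suc zero) = zero

other-≢ : ∀ c → other c ≢ c
other-≢ zero       ()
other-≢ (suc zero) ()

other-involutive : ∀ c → other (other c) ≡ c
other-involutive zero       = refl
other-involutive (suc zero) = refl

≢⇒≡other : ∀ {a c} → c ≢ a → c ≡ other a
≢⇒≡other {zero}     {zero}     c≢a = ⊥-elim (c≢a refl)
≢⇒≡other {zero}     {suc zero} _   = refl
≢⇒≡other {suc zero} {zero}     _   = refl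
≢⇒≡other {suc zero} {suc zero} c≢a = ⊥-elim (c≢a refl)

≡-or-≡other : ∀ a c → c ≡ a ⊎ c ≡ other a
≡-or-≡other a c with c ≟ a
... | yes c≡a = inj₁ c≡a
... | no  c≢a = inj₂ (≢⇒≡other c≢a)

other-in-binary : ∀ {w} → Binary w → ∀ a → ∃[ j ] w j ≡ other a
other-in-binary (_ , has-l1) zero       = has-l1
other-in-binary (has-l0 , _) (suc zero) = has-l0

count-∷-≡ : ∀ c u → count c (c ∷ u) ≡ suc (count c u)
count-∷-≡ c u with c ≟ c
... | yes _   = refl
... | no  c≢c = ⊥-elim (c≢c refl)

count-∷-≢ : ∀ {c d} u → c ≢ d → count c (d ∷ u) ≡ count c u
count-∷-≢ {c} {d} u c≢d with c ≟ d
... | yes c≡d = ⊥-elim (c≢d c≡d)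
... | no  _   = refl

count-++ : ∀ c u v → count c (u ++ v) ≡ count c u + count c v
count-++ c []      v = refl
count-++ c (d ∷ u) v with c ≟ d
... | yes _ = cong suc (count-++ c u v)
... | no  _ = count-++ c u v

split-or-count≡0 : ∀ a u → (∃[ y₁ ] ∃[ y₂ ] u ≡ y₁ ++ a ∷ y₂) ⊎ count a u ≡ 0
split-or-count≡0 a []      = inj₂ refl
split-or-count≡0 a (c ∷ u) with c ≟ a | split-or-count≡0 a u
... | yes refl | _                  = inj₁ ([] , u , refl)
... | no  _    | inj₁ (y₁ , y₂ , e) = inj₁ (c ∷ y₁ , y₂ , cong (c ∷_) e)
... | no  c≢a  | inj₂ count≡0       = inj₂ (trans (count-∷-≢ u (c≢a ∘ sym)) count≡0)

-- Parikh vectors and 2 × 2 matrices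

Vector : Set
Vector = Letter → ℕ

vector : ℕ → ℕ → Vector
vector x y zero       = x
vector x y (suc zero) = y

parikh : List Letter → Vector
parikh u c = count c u

unit : Letter → Vector
unit d = parikh (d ∷ [])

infixl 6 _⊕_
infixr 7 _⊙_

_⊕_ : Vector → Vector → Vector
(z ⊕ z′) c = z c + z′ c

_⊙_ : ℕ → Vector → Vector
(k ⊙ z) c = k * z c

parikh-++ : ∀ u v → parikh (u ++ v) ≗ parikh u ⊕ parikh v
parikh-++ u v c = count-++ c u v

unit-decomposition : ∀ z → z ≗ z l0 ⊙ unit l0 ⊕ z l1 ⊙ unit l1
unit-decomposition z zero       = coordinate (z l0) (z l1)
  where
  coordinate : ∀ x y → x ≡ x * 1 + y * 0
  coordinate = solve-∀
unit-decomposition z (suc zero) = coordinate (z l0) (z l1)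
  where
  coordinate : ∀ x y → y ≡ x * 0 + y * 1
  coordinate = solve-∀

-- A matrix is stored by its columns: M d c is the entry in row c and column d,
-- so that the columns of A_φ are the Parikh vectors of φ l0 and φ l1.
Matrix : Set
Matrix = Letter → Vector

infixr 8 _·_ _^_·_

_·_ : Matrix → Vector → Vector
(M · z) c = z l0 * M l0 c + z l1 * M l1 c

_^_·_ : Matrix → ℕ → Vector → Vector
M ^ zero  · z = z
M ^ suc n · z = M · (M ^ n · z)

·-congʳ : ∀ M {z z′} → z ≗ z′ → M · z ≗ M · z′
·-congʳ M z≗z′ c = cong₂ (λ x y → x * M l0 c + y * M l1 c) (z≗z′ l0) (z≗z′ l1)

·-unit-⊕ : ∀ M d z → M · (unit d ⊕ z) ≗ M d ⊕ M · z
·-unit-⊕ M zero       z c = add-column (z l0) (z l1) (M l0 c) (M l1 c)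
  where
  add-column : ∀ x y p q → suc x * p + y * q ≡ p + (x * p + y * q)
  add-column = solve-∀
·-unit-⊕ M (suc zero) z c = add-column (z l0) (z l1) (M l0 c) (M l1 c)
  where
  add-column : ∀ x y p q → x * p + suc y * q ≡ q + (x * p + y * q)
  add-column = solve-∀

^·-+ : ∀ M i j z → M ^ (i + j) · z ≗ M ^ i · (M ^ j · z)
^·-+ M zero    j z c = refl
^·-+ M (suc i) j z   = ·-congʳ M (^·-+ M i j z)

^·-linear : ∀ M n z c → (M ^ n · z) c ≡ z l0 * (M ^ n · unit l0) c + z l1 * (M ^ n · unit l1) c
^·-linear M zero    z c = unit-decomposition z c
^·-linear M (suc n) z c = begin
  (M ^ n · z) l0 * M l0 c + (M ^ n · z) l1 * M l1 c
    ≡⟨ cong₂ (λ x y → x * M l0 c + y * M l1 c) (^·-linear M n z l0) (^·-linear M n z l1) ⟩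
  (z l0 * u₀ l0 + z l1 * u₁ l0) * M l0 c + (z l0 * u₀ l1 + z l1 * u₁ l1) * M l1 c
    ≡⟨ distribute (z l0) (z l1) (u₀ l0) (u₁ l0) (u₀ l1) (u₁ l1) (M l0 c) (M l1 c) ⟩
  z l0 * (u₀ l0 * M l0 c + u₀ l1 * M l1 c) + z l1 * (u₁ l0 * M l0 c + u₁ l1 * M l1 c) ∎
  where
  open ≡-Reasoning
  u₀ = M ^ n · unit l0
  u₁ = M ^ n · unit l1
  distribute : ∀ x y p q r s a b →
    (x * p + y * q) * a + (x * r + y * s) * b ≡ x * (p * a + r * b) + y * (q * a + s * b)
  distribute = solve-∀

DifferByOne : ℕ → ℕ → Set
DifferByOne p q = p ≡ suc q ⊎ q ≡ suc p

differByOne-irrefl : ∀ {p q} → p ≡ q → ¬ DifferByOne p q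
differByOne-irrefl p≡q (inj₁ p≡1+q) = ℕ.1+n≢n (trans (sym p≡1+q) p≡q)
differByOne-irrefl p≡q (inj₂ q≡1+p) = ℕ.1+n≢n (trans (sym q≡1+p) (sym p≡q))

⊖≡1⇒≡suc : ∀ p q → p ℤ.⊖ q ≡ + 1 → p ≡ suc q
⊖≡1⇒≡suc zero          zero    ()
⊖≡1⇒≡suc zero          (suc q) ()
⊖≡1⇒≡suc (suc zero)    zero    _ = refl
⊖≡1⇒≡suc (suc (suc p)) zero    ()
⊖≡1⇒≡suc (suc p)       (suc q) e = cong suc (⊖≡1⇒≡suc p q (trans (sym (ℤ.[1+m]⊖[1+n]≡m⊖n p q)) e))

[+p]-[+q]≡±1⇒differByOne : ∀ p q → + p ℤ.- + q ≡ + 1 ⊎ + p ℤ.- + q ≡ - (+ 1) → DifferByOne p q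
[+p]-[+q]≡±1⇒differByOne p q = Sum.map
  (λ p-q≡1  → ⊖≡1⇒≡suc p q (trans (sym (ℤ.m-n≡m⊖n p q)) p-q≡1))
  (λ p-q≡-1 → ⊖≡1⇒≡suc q p (trans (ℤ.⊖-swap q p) (cong ℤ.-_ (trans (sym (ℤ.m-n≡m⊖n p q)) p-q≡-1))))

Unimodular : Matrix → Set
Unimodular M = DifferByOne (M l0 l0 * M l1 l1) (M l1 l0 * M l0 l1)

unimodular-at : ∀ {M} → Unimodular M → ∀ a →
                DifferByOne (M a a * M (other a) (other a)) (M (other a) a * M a (other a))
unimodular-at     unimodular zero       = unimodular
unimodular-at {M} unimodular (suc zero) =
  subst₂ DifferByOne (ℕ.*-comm (M l0 l0) (M l1 l1)) (ℕ.*-comm (M l1 l0) (M l0 l1)) unimodular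

-- If α = γ then β = δ and the determinant vanishes; if α = γ + 1 then δ = β + 1 and
-- the determinant is β + γ + 1 ≥ 2.
balanced-not-unimodular : ∀ {α β γ δ} → α ≡ γ ⊎ α ≡ suc γ → α + β ≡ γ + δ → 0 < γ →
                          ¬ DifferByOne (α * δ) (β * γ)
balanced-not-unimodular {α} {β} {γ} {δ} (inj₁ refl) sum _ with ℕ.+-cancelˡ-≡ α β δ sum
... | refl = differByOne-irrefl (ℕ.*-comm α β)
balanced-not-unimodular {β = β} {suc γ′} {δ} (inj₂ refl) sum _
  with ℕ.+-cancelˡ-≡ (suc γ′) (suc β) δ (trans (ℕ.+-suc (suc γ′) β) sum)
... | refl = λ
  { (inj₁ e) → ℕ.m+1+n≢m (β * suc γ′) (ℕ.suc-injective (trans (sym (expand β γ′)) e))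
  ; (inj₂ e) → ℕ.m≢1+m+n (β * suc γ′) (trans e (expand′ β γ′))
  }
  where
  expand : ∀ b g → suc (suc g) * suc b ≡ suc (b * suc g + suc (b + g))
  expand = solve-∀
  expand′ : ∀ b g → 1 + suc (suc g) * suc b ≡ suc (b * suc g + suc (suc (b + g)))
  expand′ = solve-∀

parikhMatrix : Morphism → Matrix
parikhMatrix φ d = parikh (φ d)

unimodular-parikhMatrix : ∀ φ → detA φ ≡ + 1 ⊎ detA φ ≡ - (+ 1) → Unimodular (parikhMatrix φ)
unimodular-parikhMatrix φ =
  [+p]-[+q]≡±1⇒differByOne (count l0 (φ l0) * count l1 (φ l1)) (count l0 (φ l1) * count l1 (φ l0))

length-nonempty : ∀ {A : Set} (xs : List A) → xs ≢ [] → 0 < length xs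
length-nonempty []      xs≢[] = ⊥-elim (xs≢[] refl)
length-nonempty (_ ∷ _) _     = s≤s z≤n

module _ (φ : Morphism) where

  apply-++ : ∀ u v → apply φ (u ++ v) ≡ apply φ u ++ apply φ v
  apply-++ u v = trans (cong concat (List.map-++ φ u v)) (sym (List.concat-++ (map φ u) (map φ v)))

  iter-++ : ∀ n u v → iter φ n (u ++ v) ≡ iter φ n u ++ iter φ n v
  iter-++ zero    u v = refl
  iter-++ (suc n) u v = trans (cong (apply φ) (iter-++ n u v)) (apply-++ (iter φ n u) (iter φ n v))

  iter-suc : ∀ n u → iter φ (suc n) u ≡ iter φ n (apply φ u)
  iter-suc zero    u = refl
  iter-suc (suc n) u = cong (apply φ) (iter-suc n u)

  length-apply : Nonerasing φ → ∀ u → length u ≤ length (apply φ u)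
  length-apply ne []      = z≤n
  length-apply ne (c ∷ u) with φ c in φc≡
  ... | []    = ⊥-elim (ne c φc≡)
  ... | _ ∷ t = s≤s (ℕ.≤-trans (length-apply ne u) (List.length-++-≤ʳ (apply φ u) {t}))

  parikh-apply : ∀ u → parikh (apply φ u) ≗ parikhMatrix φ · parikh u
  parikh-apply []      c = refl
  parikh-apply (d ∷ u) c = begin
    count c (φ d ++ apply φ u)                  ≡⟨ count-++ c (φ d) (apply φ u) ⟩
    count c (φ d) + count c (apply φ u)         ≡⟨ cong (λ x → count c (φ d) + x) (parikh-apply u c) ⟩
    (A d ⊕ A · parikh u) c                      ≡⟨ ·-unit-⊕ A d (parikh u) c ⟨
    (A · (unit d ⊕ parikh u)) c                 ≡⟨ ·-congʳ A (parikh-++ (d ∷ []) u) c ⟨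
    (A · parikh (d ∷ u)) c                      ∎
    where
    open ≡-Reasoning
    A = parikhMatrix φ

  parikh-iter : ∀ n u → parikh (iter φ n u) ≗ parikhMatrix φ ^ n · parikh u
  parikh-iter zero    u c = refl
  parikh-iter (suc n) u c =
    trans (parikh-apply (iter φ n u) c) (·-congʳ (parikhMatrix φ) (parikh-iter n u) c)

-- Unimodular matrices have finite order modulo m

ℕ→Fin-repeats : ∀ {K} (f : ℕ → Fin K) → ∃[ i ] ∃[ d ] f i ≡ f (i + suc d)
ℕ→Fin-repeats {K} f with Fin.pigeonhole (ℕ.n<1+n K) (λ i → f (toℕ i))
... | i , j , i<j , fi≡fj = toℕ i , toℕ j ∸ suc (toℕ i) , trans fi≡fj (cong f (sym i+[1+d]≡j))
  where
  i+[1+d]≡j : toℕ i + suc (toℕ j ∸ suc (toℕ i)) ≡ toℕ j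
  i+[1+d]≡j = trans (ℕ.+-suc (toℕ i) _) (ℕ.m+[n∸m]≡n i<j)

funToFin-injective : ∀ {m n} (f g : Fin m → Fin n) → funToFin f ≡ funToFin g → f ≗ g
funToFin-injective f g e i =
  trans (sym (Fin.finToFun-funToFin f i)) (trans (cong (λ k → finToFun k i) e) (Fin.finToFun-funToFin g i))

module Congruence (m : ℕ) .{{_ : NonZero m}} where

  infix 4 _≋_ _≈_

  record _≋_ (x y : ℕ) : Set where
    constructor mk
    field
      %-≡ : x % m ≡ y % m
  open _≋_ public

  ≋-reflexive : ∀ {x y} → x ≡ y → x ≋ y
  ≋-reflexive x≡y = mk (cong (_% m) x≡y)

  ≋-refl : ∀ {x} → x ≋ x
  ≋-refl = mk refl

  ≋-sym : ∀ {x y} → x ≋ y → y ≋ x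
  ≋-sym (mk p) = mk (sym p)

  ≋-trans : ∀ {x y z} → x ≋ y → y ≋ z → x ≋ z
  ≋-trans (mk p) (mk q) = mk (trans p q)

  ≋-setoid : Setoid _ _
  ≋-setoid = record
    { Carrier       = ℕ
    ; _≈_           = _≋_
    ; isEquivalence = record { refl = ≋-refl ; sym = ≋-sym ; trans = ≋-trans }
    }

  mod-≡⇒≋ : ∀ {x y} → x mod m ≡ y mod m → x ≋ y
  mod-≡⇒≋ e = mk (trans (sym (Fin.toℕ-fromℕ< _)) (trans (cong toℕ e) (Fin.toℕ-fromℕ< _)))

  +-cong : ∀ {x x′ y y′} → x ≋ x′ → y ≋ y′ → x + y ≋ x′ + y′
  +-cong {x} {x′} {y} {y′} (mk p) (mk q) = mk (begin
    (x + y) % m              ≡⟨ %-distribˡ-+ x y m ⟩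
    (x % m + y % m) % m      ≡⟨ cong₂ (λ u v → (u + v) % m) p q ⟩
    (x′ % m + y′ % m) % m    ≡⟨ %-distribˡ-+ x′ y′ m ⟨
    (x′ + y′) % m            ∎)
    where open ≡-Reasoning

  *-congˡ : ∀ k {x x′} → x ≋ x′ → k * x ≋ k * x′
  *-congˡ k {x} {x′} (mk p) = mk (begin
    (k * x) % m              ≡⟨ %-distribˡ-* k x m ⟩
    (k % m * (x % m)) % m    ≡⟨ cong (λ u → (k % m * u) % m) p ⟩
    (k % m * (x′ % m)) % m   ≡⟨ %-distribˡ-* k x′ m ⟨
    (k * x′) % m             ∎)
    where open ≡-Reasoning

  *-congʳ : ∀ k {x x′} → x ≋ x′ → x * k ≋ x′ * k
  *-congʳ k {x} {x′} p = subst₂ _≋_ (ℕ.*-comm k x) (ℕ.*-comm k x′) (*-congˡ k p)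

  -- pred m plays the role of -1 modulo m.
  +-inverse : ∀ x k → x + k + pred m * k ≋ x
  +-inverse x k = mk (begin
    (x + k + pred m * k) % m    ≡⟨ cong (_% m) (collect x k (pred m)) ⟩
    (x + k * suc (pred m)) % m  ≡⟨ cong (λ n → (x + k * n) % m) (ℕ.suc-pred m) ⟩
    (x + k * m) % m             ≡⟨ [m+kn]%n≡m%n x k m ⟩
    x % m                       ∎)
    where
    open ≡-Reasoning
    collect : ∀ x k n → x + k + n * k ≡ x + k * suc n
    collect = solve-∀

  +-cancelʳ : ∀ {x x′} k → x + k ≋ x′ + k → x ≋ x′
  +-cancelʳ {x} {x′} k h = begin
    x                        ≈⟨ +-inverse x k ⟨
    x + k + pred m * k       ≈⟨ +-cong h ≋-refl ⟩
    x′ + k + pred m * k      ≈⟨ +-inverse x′ k ⟩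
    x′                       ∎
    where open Relation.Binary.Reasoning.Setoid ≋-setoid

  differByOne-cancel : ∀ {P Q x x′} K → DifferByOne P Q →
                       P * x + Q * x′ + K ≋ P * x′ + Q * x + K → x ≋ x′
  differByOne-cancel {Q = Q} {x} {x′} K (inj₁ refl) h = +-cancelʳ (Q * x + Q * x′ + K) (begin
    x + (Q * x + Q * x′ + K)    ≡⟨ rearrange Q x x′ K ⟩
    suc Q * x + Q * x′ + K      ≈⟨ h ⟩
    suc Q * x′ + Q * x + K      ≡⟨ rearrange′ Q x x′ K ⟨
    x′ + (Q * x + Q * x′ + K)   ∎)
    where
    open Relation.Binary.Reasoning.Setoid ≋-setoid
    rearrange : ∀ Q x x′ K → x + (Q * x + Q * x′ + K) ≡ suc Q * x + Q * x′ + K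
    rearrange = solve-∀
    rearrange′ : ∀ Q x x′ K → x′ + (Q * x + Q * x′ + K) ≡ suc Q * x′ + Q * x + K
    rearrange′ = solve-∀
  differByOne-cancel {P} {x = x} {x′} K (inj₂ refl) h =
    differByOne-cancel {suc P} {P} K (inj₁ refl) (begin
      suc P * x + P * x′ + K   ≡⟨ swap (suc P * x) (P * x′) ⟩
      P * x′ + suc P * x + K   ≈⟨ h ⟨
      P * x + suc P * x′ + K   ≡⟨ swap (P * x) (suc P * x′) ⟩
      suc P * x′ + P * x + K   ∎)
    where
    open Relation.Binary.Reasoning.Setoid ≋-setoid
    swap : ∀ a b → a + b + K ≡ b + a + K
    swap a b = cong (_+ K) (ℕ.+-comm a b)

  _≈_ : Vector → Vector → Set
  z ≈ z′ = ∀ c → z c ≋ z′ c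

  ≈-reflexive : ∀ {z z′} → z ≗ z′ → z ≈ z′
  ≈-reflexive z≗z′ c = ≋-reflexive (z≗z′ c)

  ≈-refl : ∀ {z} → z ≈ z
  ≈-refl c = ≋-refl

  ≈-sym : ∀ {z z′} → z ≈ z′ → z′ ≈ z
  ≈-sym p c = ≋-sym (p c)

  ≈-trans : ∀ {z z′ z″} → z ≈ z′ → z′ ≈ z″ → z ≈ z″
  ≈-trans p q c = ≋-trans (p c) (q c)

  ≈-by-letters : ∀ {z z′} → z l0 ≋ z′ l0 → z l1 ≋ z′ l1 → z ≈ z′
  ≈-by-letters p q zero       = p
  ≈-by-letters p q (suc zero) = q

  ⊕-cong : ∀ {z z′ t t′} → z ≈ z′ → t ≈ t′ → z ⊕ t ≈ z′ ⊕ t′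
  ⊕-cong p q c = +-cong (p c) (q c)

  ·-cong : ∀ M {z z′} → z ≈ z′ → M · z ≈ M · z′
  ·-cong M p c = +-cong (*-congʳ (M l0 c) (p l0)) (*-congʳ (M l1 c) (p l1))

  ^·-cong : ∀ M n {z z′} → z ≈ z′ → M ^ n · z ≈ M ^ n · z′
  ^·-cong M zero    p = p
  ^·-cong M (suc n) p = ·-cong M (^·-cong M n p)

  units-determine-^· : ∀ M i j → (∀ d → M ^ i · unit d ≈ M ^ j · unit d) → ∀ z → M ^ i · z ≈ M ^ j · z
  units-determine-^· M i j h z c = begin
    (M ^ i · z) c                                             ≡⟨ ^·-linear M i z c ⟩
    z l0 * (M ^ i · unit l0) c + z l1 * (M ^ i · unit l1) c   ≈⟨ +-cong (*-congˡ (z l0) (h l0 c)) (*-congˡ (z l1) (h l1 c)) ⟩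
    z l0 * (M ^ j · unit l0) c + z l1 * (M ^ j · unit l1) c   ≡⟨ ^·-linear M j z c ⟨
    (M ^ j · z) c                                             ∎
    where open Relation.Binary.Reasoning.Setoid ≋-setoid

  -- Crossing the two congruences with δ and β, the first row of the adjugate, leaves
  -- (αδ − βγ)(x − x′) ≋ 0.
  cramer : ∀ α β γ δ x y x′ y′ → DifferByOne (α * δ) (β * γ) →
           x * α + y * β ≋ x′ * α + y′ * β → x * γ + y * δ ≋ x′ * γ + y′ * δ → x ≋ x′
  cramer α β γ δ x y x′ y′ det e₁ e₂ = differByOne-cancel (β * δ * (y + y′)) det (begin
    α * δ * x + β * γ * x′ + β * δ * (y + y′)     ≡⟨ regroup α β γ δ x y x′ y′ ⟨
    δ * (x * α + y * β) + β * (x′ * γ + y′ * δ)   ≈⟨ +-cong (*-congˡ δ e₁) (*-congˡ β (≋-sym e₂)) ⟩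
    δ * (x′ * α + y′ * β) + β * (x * γ + y * δ)   ≡⟨ regroup′ α β γ δ x y x′ y′ ⟩
    α * δ * x′ + β * γ * x + β * δ * (y + y′)     ∎)
    where
    open Relation.Binary.Reasoning.Setoid ≋-setoid
    regroup : ∀ α β γ δ x y x′ y′ →
      δ * (x * α + y * β) + β * (x′ * γ + y′ * δ) ≡ α * δ * x + β * γ * x′ + β * δ * (y + y′)
    regroup = solve-∀
    regroup′ : ∀ α β γ δ x y x′ y′ →
      δ * (x′ * α + y′ * β) + β * (x * γ + y * δ) ≡ α * δ * x′ + β * γ * x + β * δ * (y + y′)
    regroup′ = solve-∀

  module _ {M : Matrix} (unimodular : Unimodular M) where

    ·-cancel : ∀ {z z′} → M · z ≈ M · z′ → z ≈ z′
    ·-cancel {z} {z′} h = ≈-by-letters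
      (cramer α β γ δ x y x′ y′ unimodular (h l0) (h l1))
      (cramer δ γ β α y x y′ x′ (subst₂ DifferByOne (ℕ.*-comm α δ) (ℕ.*-comm β γ) unimodular) row₁ row₀)
      where
      α = M l0 l0
      β = M l1 l0
      γ = M l0 l1
      δ = M l1 l1
      x = z l0
      y = z l1
      x′ = z′ l0
      y′ = z′ l1
      row₀ : y * β + x * α ≋ y′ * β + x′ * α
      row₀ = subst₂ _≋_ (ℕ.+-comm (x * α) (y * β)) (ℕ.+-comm (x′ * α) (y′ * β)) (h l0)
      row₁ : y * δ + x * γ ≋ y′ * δ + x′ * γ
      row₁ = subst₂ _≋_ (ℕ.+-comm (x * γ) (y * δ)) (ℕ.+-comm (x′ * γ) (y′ * δ)) (h l1)

    ^·-cancel : ∀ n {z z′} → M ^ n · z ≈ M ^ n · z′ → z ≈ z′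
    ^·-cancel zero    h = h
    ^·-cancel (suc n) h = ^·-cancel n (·-cancel h)

    -- The residues of the entries of M^i repeat, and M can be cancelled.
    finite-order : ∃[ N ] ∀ z → M ^ suc N · z ≈ z
    finite-order = period (ℕ→Fin-repeats residues)
      where
      entry : ℕ → Letter → Letter → Fin m
      entry n d c = (M ^ n · unit d) c mod m
      residues : ℕ → Fin (Data.Nat._^_ (Data.Nat._^_ m 2) 2)
      residues n = funToFin (λ d → funToFin (entry n d))
      period : (∃[ i ] ∃[ d ] residues i ≡ residues (i + suc d)) → ∃[ N ] ∀ z → M ^ suc N · z ≈ z
      period (i , N , same) = N , λ z → ≈-sym (^·-cancel i (≈-trans
          (units-determine-^· M i j (λ d c → mod-≡⇒≋ (entries-agree d c)) z)
          (≈-reflexive (^·-+ M i (suc N) z))))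
        where
        j = i + suc N
        entries-agree : ∀ d c → entry i d c ≡ entry j d c
        entries-agree d = funToFin-injective (entry i d) (entry j d)
          (funToFin-injective (λ d → funToFin (entry i d)) (λ d → funToFin (entry j d)) same d)

-- Alternating words

iterate-prefix : ∀ {A : Set} (f : A → A) x n u {v} → u ++ v ≡ iterate f x n → u ≡ iterate f x (length u)
iterate-prefix f x n       []      e = refl
iterate-prefix f x (suc n) (c ∷ u) e =
  cong₂ _∷_ (List.∷-injectiveˡ e) (iterate-prefix f (f x) n u (List.∷-injectiveʳ e))

HasSquare : List Letter → Set
HasSquare u = ∃[ y ] ∃[ c ] ∃[ v ] u ≡ y ++ c ∷ c ∷ v

square-or-alternating : ∀ h u → HasSquare (h ∷ u) ⊎ h ∷ u ≡ iterate other h (suc (length u))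
square-or-alternating h []      = inj₂ refl
square-or-alternating h (c ∷ u) with c ≟ h | square-or-alternating c u
... | yes refl | _                  = inj₁ ([] , c , u , refl)
... | no  _    | inj₁ (y , d , v , e) = inj₁ (h ∷ y , d , v , cong (h ∷_) e)
... | no  c≢h  | inj₂ e =
  inj₂ (cong (h ∷_) (subst (λ d → c ∷ u ≡ iterate other d (suc (length u))) (≢⇒≡other c≢h) e))

AtMostOneMore : ℕ → ℕ → Set
AtMostOneMore p q = p ≡ q ⊎ p ≡ suc q

atMostOneMore-suc : ∀ {p q} → AtMostOneMore q p → AtMostOneMore (suc p) q
atMostOneMore-suc (inj₁ q≡p)   = inj₂ (cong suc (sym q≡p))
atMostOneMore-suc (inj₂ q≡1+p) = inj₁ (sym q≡1+p)

atMostOneMore-halve : ∀ {p q} → AtMostOneMore (2 * p) (2 * q) → p ≡ q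
atMostOneMore-halve {p} {q} (inj₁ e) = ℕ.*-cancelˡ-≡ p q 2 e
atMostOneMore-halve {p} {q} (inj₂ e) = ⊥-elim (ℕ.even≢odd p q e)

Balanced : Letter → Vector → Set
Balanced h z = AtMostOneMore (z h) (z (other h))

balanced-alternating : ∀ h n → Balanced h (parikh (iterate other h n))
balanced-alternating h          zero    = inj₁ refl
balanced-alternating zero       (suc n) = atMostOneMore-suc (balanced-alternating (suc zero) n)
balanced-alternating (suc zero) (suc n) = atMostOneMore-suc (balanced-alternating zero n)

step-off : ∀ {A : Set} (_≟ᴬ_ : DecidableEquality A) (f : ℕ → A) {c} i d →
           f i ≡ c → f (i + d) ≢ c → ∃[ k ] f k ≡ c × f (suc k) ≢ c
step-off _≟ᴬ_ f i zero    fi≡c fi≢c = ⊥-elim (fi≢c (trans (cong f (ℕ.+-identityʳ i)) fi≡c))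
step-off _≟ᴬ_ f {c} i (suc d) fi≡c f[i+1+d]≢c with f (suc i) ≟ᴬ c
... | no  f[1+i]≢c = i , fi≡c , f[1+i]≢c
... | yes f[1+i]≡c = step-off _≟ᴬ_ f (suc i) d f[1+i]≡c (subst (λ n → f n ≢ c) (ℕ.+-suc i d) f[i+1+d]≢c)

module Prefixes (w : InfWord) where

  IsPrefix : List Letter → Set
  IsPrefix v = prefix w (length v) ≡ v

  length-factorAt : ∀ i n → length (factorAt w i n) ≡ n
  length-factorAt i zero    = refl
  length-factorAt i (suc n) = cong suc (length-factorAt (suc i) n)

  factorAt-+ : ∀ i p q → factorAt w i (p + q) ≡ factorAt w i p ++ factorAt w (i + p) q
  factorAt-+ i zero    q = cong (λ j → factorAt w j q) (sym (ℕ.+-identityʳ i))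
  factorAt-+ i (suc p) q = cong (w i ∷_) (trans (factorAt-+ (suc i) p q)
    (cong (λ j → factorAt w (suc i) p ++ factorAt w j q) (sym (ℕ.+-suc i p))))

  factorAt-++⁻ : ∀ i u v → factorAt w i (length (u ++ v)) ≡ u ++ v →
                 factorAt w i (length u) ≡ u × factorAt w (i + length u) (length v) ≡ v
  factorAt-++⁻ i []      v e = refl , subst (λ j → factorAt w j (length v) ≡ v) (sym (ℕ.+-identityʳ i)) e
  factorAt-++⁻ i (c ∷ u) v e with factorAt-++⁻ (suc i) u v (List.∷-injectiveʳ e)
  ... | u-part , v-part =
    cong₂ _∷_ (List.∷-injectiveˡ e) u-part ,
    subst (λ j → factorAt w j (length v) ≡ v) (sym (ℕ.+-suc i (length u))) v-part

  isPrefix-prefix : ∀ n → IsPrefix (prefix w n)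
  isPrefix-prefix n = cong (prefix w) (length-factorAt 0 n)

  isPrefix-++⁻ˡ : ∀ u {v} → IsPrefix (u ++ v) → IsPrefix u
  isPrefix-++⁻ˡ u {v} p = proj₁ (factorAt-++⁻ 0 u v p)

  isPrefix⇒occursAt : ∀ y {u} → IsPrefix (y ++ u) → OccursAt u w (length y)
  isPrefix⇒occursAt y {u} p = proj₂ (factorAt-++⁻ 0 y u p)

  occursAt⇒isPrefix : ∀ {u p} → OccursAt u w p → IsPrefix (prefix w p ++ u)
  occursAt⇒isPrefix {u} {p} occ = begin
    prefix w (length (prefix w p ++ u))    ≡⟨ cong (prefix w) |prefix++u|≡p+|u| ⟩
    prefix w (p + length u)                ≡⟨ factorAt-+ 0 p (length u) ⟩
    prefix w p ++ factorAt w p (length u)  ≡⟨ cong (prefix w p ++_) occ ⟩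
    prefix w p ++ u                        ∎
    where
    open ≡-Reasoning
    |prefix++u|≡p+|u| : length (prefix w p ++ u) ≡ p + length u
    |prefix++u|≡p+|u| = trans (List.length-++ (prefix w p)) (cong (_+ length u) (length-factorAt 0 p))

  occursAt-pair : ∀ {k c d} → w k ≡ c → w (suc k) ≡ d → OccursAt (c ∷ d ∷ []) w k
  occursAt-pair = cong₂ (λ c d → c ∷ d ∷ [])

  isPrefix-extends : ∀ {u v} → IsPrefix u → IsPrefix v → length u ≤ length v → ∃[ r ] v ≡ u ++ r
  isPrefix-extends {u} {v} pu pv |u|≤|v| = factorAt w (length u) d , (begin
    v                                               ≡⟨ pv ⟨
    prefix w (length v)                             ≡⟨ cong (prefix w) (ℕ.m+[n∸m]≡n |u|≤|v|) ⟨
    prefix w (length u + d)                         ≡⟨ factorAt-+ 0 (length u) d ⟩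
    prefix w (length u) ++ factorAt w (length u) d  ≡⟨ cong (_++ factorAt w (length u) d) pu ⟩
    u ++ factorAt w (length u) d                    ∎)
    where
    open ≡-Reasoning
    d = length v ∸ length u

-- Words generated by a morphism

module Generated (φ : Morphism) (w : InfWord) (nonerasing : Nonerasing φ)
                 (a : Letter) (s : List Letter) (φa≡ : φ a ≡ a ∷ s) (s≢[] : s ≢ [])
                 (generated : ∀ n → prefix w (length (iter φ n (a ∷ []))) ≡ iter φ n (a ∷ [])) where

  open Prefixes w

  b : Letter
  b = other a

  b≢a : b ≢ a
  b≢a = other-≢ a

  A : Matrix
  A = parikhMatrix φ

  w0≡a : w 0 ≡ a
  w0≡a = List.∷-injectiveˡ (generated 0)

  a-is-factor : IsFactor (a ∷ []) w
  a-is-factor = 0 , cong (_∷ []) w0≡a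

  iter-a-shape : ∀ n → ∃[ t ] iter φ n (a ∷ []) ≡ a ∷ t × n ≤ length t
  iter-a-shape zero = [] , refl , z≤n
  iter-a-shape (suc n) with iter-a-shape n
  ... | t , e , n≤|t| = s ++ apply φ t , trans (cong (apply φ) e) (cong (_++ apply φ t) φa≡) , (begin
    suc n                          ≤⟨ ℕ.+-mono-≤ (length-nonempty s s≢[]) (ℕ.≤-trans n≤|t| (length-apply φ nonerasing t)) ⟩
    length s + length (apply φ t)  ≡⟨ List.length-++ s ⟨
    length (s ++ apply φ t)        ∎)
    where open ℕ.≤-Reasoning

  iter-a-extends : ∀ {P} n → IsPrefix P → length P ≤ n → ∃[ r ] iter φ n (a ∷ []) ≡ P ++ r
  iter-a-extends {P} n pP |P|≤n with iter-a-shape n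
  ... | t , e , n≤|t| = isPrefix-extends pP (generated n)
    (ℕ.≤-trans |P|≤n (ℕ.≤-trans (ℕ.m≤n⇒m≤1+n n≤|t|) (ℕ.≤-reflexive (cong length (sym e)))))

  isPrefix-apply : ∀ {v} → IsPrefix v → IsPrefix (apply φ v)
  isPrefix-apply {v} pv with iter-a-extends (length v) pv ℕ.≤-refl
  ... | r , e = isPrefix-++⁻ˡ (apply φ v)
    (subst IsPrefix (trans (cong (apply φ) e) (apply-++ φ v r)) (generated (suc (length v))))

  isPrefix-iter : ∀ n {v} → IsPrefix v → IsPrefix (iter φ n v)
  isPrefix-iter zero    pv = pv
  isPrefix-iter (suc n) pv = isPrefix-apply (isPrefix-iter n pv)

  ab-occurs : Binary w → ∃[ k ] OccursAt (a ∷ b ∷ []) w k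
  ab-occurs binary with other-in-binary binary a
  ... | j , wj≡b with step-off _≟_ w 0 j w0≡a (λ wj≡a → b≢a (trans (sym wj≡b) wj≡a))
  ...   | k , wk≡a , wk+1≢a = k , occursAt-pair wk≡a (≢⇒≡other wk+1≢a)

  ba-occurs : Binary w → Recurrent w → ∃[ k ] OccursAt (b ∷ a ∷ []) w k
  ba-occurs binary recurrent with other-in-binary binary a
  ... | j , wj≡b with recurrent (a ∷ []) a-is-factor (suc j)
  ...   | p , j<p , occ with step-off _≟_ w j (p ∸ j) wj≡b (λ w[j+[p∸j]]≡b → b≢a (begin
          b                ≡⟨ w[j+[p∸j]]≡b ⟨
          w (j + (p ∸ j))  ≡⟨ cong w (ℕ.m+[n∸m]≡n (ℕ.<⇒≤ j<p)) ⟩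
          w p              ≡⟨ List.∷-injectiveˡ occ ⟩
          a                ∎))
    where open ≡-Reasoning
  ...     | k , wk≡b , wk+1≢b = k , occursAt-pair wk≡b (trans (≢⇒≡other wk+1≢b) (other-involutive a))

  count-a-iter-a≡1 : count a (φ a) ≡ 1 → count a (φ b) ≡ 0 → ∀ n → count a (iter φ n (a ∷ [])) ≡ 1
  count-a-iter-a≡1 α≡1 β≡0 zero    = count-∷-≡ a []
  count-a-iter-a≡1 α≡1 β≡0 (suc n) = trans (count-a-apply (iter φ n (a ∷ []))) (count-a-iter-a≡1 α≡1 β≡0 n)
    where
    open ≡-Reasoning
    count-a-apply : ∀ v → count a (apply φ v) ≡ count a v
    count-a-apply []      = refl
    count-a-apply (d ∷ v) with ≡-or-≡other a d
    ... | inj₁ refl = begin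
      count a (φ a ++ apply φ v)            ≡⟨ count-++ a (φ a) (apply φ v) ⟩
      count a (φ a) + count a (apply φ v)   ≡⟨ cong₂ _+_ α≡1 (count-a-apply v) ⟩
      suc (count a v)                       ≡⟨ count-∷-≡ a v ⟨
      count a (a ∷ v)                       ∎
    ... | inj₂ refl = begin
      count a (φ b ++ apply φ v)            ≡⟨ count-++ a (φ b) (apply φ v) ⟩
      count a (φ b) + count a (apply φ v)   ≡⟨ cong₂ _+_ β≡0 (count-a-apply v) ⟩
      count a v                             ≡⟨ count-∷-≢ v (b≢a ∘ sym) ⟨
      count a (b ∷ v)                       ∎

  count-a-prefix++a≥2 : ∀ p → 2 ≤ count a (prefix w (suc p) ++ a ∷ [])
  count-a-prefix++a≥2 p = begin
    2                                     ≤⟨ s≤s (ℕ.m≤n+m 1 (count a F)) ⟩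
    suc (count a F + 1)                   ≡⟨ cong (λ k → suc (count a F + k)) (count-∷-≡ a []) ⟨
    suc (count a F + count a (a ∷ []))    ≡⟨ cong suc (count-++ a F (a ∷ [])) ⟨
    suc (count a (F ++ a ∷ []))           ≡⟨ count-∷-≡ a (F ++ a ∷ []) ⟨
    count a (a ∷ F ++ a ∷ [])             ≡⟨ cong (λ c → count a (c ∷ F ++ a ∷ [])) w0≡a ⟨
    count a (w 0 ∷ F ++ a ∷ [])           ∎
    where
    open ℕ.≤-Reasoning
    F = factorAt w 1 p

  a-in-φb : Recurrent w → Unimodular A → ∃[ y₁ ] ∃[ y₂ ] φ b ≡ y₁ ++ a ∷ y₂
  a-in-φb recurrent unimodular with split-or-count≡0 a (φ b)
  ... | inj₁ split = split
  ... | inj₂ β≡0 with recurrent (a ∷ []) a-is-factor 1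
  ...   | suc p , _ , occ with iter-a-extends _ (occursAt⇒isPrefix occ) ℕ.≤-refl
  ...     | r , e = ⊥-elim (ℕ.<-irrefl refl (begin
    2                                            ≤⟨ count-a-prefix++a≥2 p ⟩
    count a P                                    ≤⟨ ℕ.m≤m+n (count a P) (count a r) ⟩
    count a P + count a r                        ≡⟨ count-++ a P r ⟨
    count a (P ++ r)                             ≡⟨ cong (count a) e ⟨
    count a (iter φ (length P) (a ∷ []))         ≡⟨ count-a-iter-a≡1 α≡1 β≡0 (length P) ⟩
    1                                            ∎))
    where
    open ℕ.≤-Reasoning
    P = prefix w (suc p) ++ a ∷ []
    γ = count b (φ a)
    α≡1 : count a (φ a) ≡ 1
    α≡1 with unimodular-at {A} unimodular a
    ... | inj₁ αδ≡1+βγ = ℕ.m*n≡1⇒m≡1 _ _ (trans αδ≡1+βγ (cong (λ β → suc (β * γ)) β≡0))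
    ... | inj₂ βγ≡1+αδ = ⊥-elim (ℕ.1+n≢0 (trans (sym βγ≡1+αδ) (cong (_* γ) β≡0)))

  a-in-iter-b : ∀ {y₁ y₂} → φ b ≡ y₁ ++ a ∷ y₂ →
                ∀ n → ∃[ r ] iter φ (suc n) (b ∷ []) ≡ iter φ n y₁ ++ a ∷ r
  a-in-iter-b {y₁} {y₂} φb≡ n with iter-a-shape n
  ... | t , e , _ = t ++ iter φ n (y₂ ++ []) , (begin
    iter φ (suc n) (b ∷ [])                                 ≡⟨ iter-suc φ n (b ∷ []) ⟩
    iter φ n (φ b ++ [])                                    ≡⟨ cong (λ v → iter φ n (v ++ [])) φb≡ ⟩
    iter φ n ((y₁ ++ a ∷ y₂) ++ [])                         ≡⟨ cong (iter φ n) (List.++-assoc y₁ (a ∷ y₂) []) ⟩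
    iter φ n (y₁ ++ (a ∷ []) ++ y₂ ++ [])                   ≡⟨ iter-++ φ n y₁ _ ⟩
    iter φ n y₁ ++ iter φ n ((a ∷ []) ++ y₂ ++ [])          ≡⟨ cong (iter φ n y₁ ++_) (iter-++ φ n (a ∷ []) (y₂ ++ [])) ⟩
    iter φ n y₁ ++ iter φ n (a ∷ []) ++ iter φ n (y₂ ++ []) ≡⟨ cong (λ v → iter φ n y₁ ++ v ++ iter φ n (y₂ ++ [])) e ⟩
    iter φ n y₁ ++ a ∷ t ++ iter φ n (y₂ ++ [])             ∎)
    where open ≡-Reasoning

  abab : List Letter
  abab = a ∷ b ∷ a ∷ b ∷ []

  count-apply-abab : ∀ c → count c (apply φ abab) ≡ 2 * (count c (φ a) + count c (φ b))
  count-apply-abab c = begin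
    count c (φ a ++ φ b ++ φ a ++ φ b ++ [])  ≡⟨ count-++ c (φ a) _ ⟩
    α + count c (φ b ++ φ a ++ φ b ++ [])     ≡⟨ cong (λ k → α + k) (count-++ c (φ b) _) ⟩
    α + (β + count c (φ a ++ φ b ++ []))      ≡⟨ cong (λ k → α + (β + k)) (count-++ c (φ a) _) ⟩
    α + (β + (α + count c (φ b ++ [])))       ≡⟨ cong (λ k → α + (β + (α + k))) (count-++ c (φ b) []) ⟩
    α + (β + (α + (β + 0)))                   ≡⟨ twice α β ⟩
    2 * (α + β)                               ∎
    where
    open ≡-Reasoning
    α = count c (φ a)
    β = count c (φ b)
    twice : ∀ p q → p + (q + (p + (q + 0))) ≡ 2 * (p + q)
    twice = solve-∀

  Alternates : ℕ → Set
  Alternates n = prefix w n ≡ iterate other a n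

  alternates-isPrefix : ∀ {n u} → Alternates n → IsPrefix u → length u ≤ n → u ≡ iterate other a (length u)
  alternates-isPrefix {n} {u} alt pu |u|≤n
    with isPrefix-extends pu (isPrefix-prefix n) (ℕ.≤-trans |u|≤n (ℕ.≤-reflexive (sym (length-factorAt 0 n))))
  ... | r , e = iterate-prefix other a n u (trans (sym e) alt)

  alternating-second-letter : ∀ t → t ≢ [] → a ∷ t ≡ iterate other a (suc (length t)) → 0 < count b (a ∷ t)
  alternating-second-letter []      t≢[] _ = ⊥-elim (t≢[] refl)
  alternating-second-letter (c ∷ t) _    e with List.∷-injectiveˡ (List.∷-injectiveʳ e)
  ... | refl = subst (0 <_) (sym (trans (count-∷-≢ (b ∷ t) b≢a) (count-∷-≡ b t))) (s≤s z≤n)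

  window : ℕ
  window = length (apply φ (prefix w 4))

  ¬alternates : Unimodular A → ¬ Alternates (suc window)
  ¬alternates unimodular alt = balanced-not-unimodular φa-balanced row-sums γ>0 (unimodular-at {A} unimodular a)
    where
    4≤window : 4 ≤ window
    4≤window = ℕ.≤-trans (ℕ.≤-reflexive (sym (length-factorAt 0 4))) (length-apply φ nonerasing (prefix w 4))
    prefix4≡abab : prefix w 4 ≡ abab
    prefix4≡abab = trans
      (alternates-isPrefix alt (isPrefix-prefix 4)
        (ℕ.m≤n⇒m≤1+n (ℕ.≤-trans (ℕ.≤-reflexive (length-factorAt 0 4)) 4≤window)))
      (cong (λ c → a ∷ b ∷ c ∷ other c ∷ []) (other-involutive a))
    φabab-alternates : apply φ abab ≡ iterate other a (length (apply φ abab))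
    φabab-alternates = alternates-isPrefix alt (isPrefix-apply (subst IsPrefix prefix4≡abab (isPrefix-prefix 4)))
      (ℕ.m≤n⇒m≤1+n (ℕ.≤-reflexive (cong (λ v → length (apply φ v)) (sym prefix4≡abab))))
    φa-alternates : φ a ≡ iterate other a (length (φ a))
    φa-alternates = iterate-prefix other a _ (φ a) φabab-alternates
    φa-balanced : Balanced a (parikh (φ a))
    φa-balanced = subst (Balanced a ∘ parikh) (sym φa-alternates) (balanced-alternating a (length (φ a)))
    row-sums : count a (φ a) + count a (φ b) ≡ count b (φ a) + count b (φ b)
    row-sums = atMostOneMore-halve (subst₂ AtMostOneMore (count-apply-abab a) (count-apply-abab b)
      (subst (Balanced a ∘ parikh) (sym φabab-alternates) (balanced-alternating a (length (apply φ abab)))))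
    γ>0 : 0 < count b (φ a)
    γ>0 = subst (λ v → 0 < count b v) (sym φa≡)
      (alternating-second-letter s s≢[] (subst (λ v → v ≡ iterate other a (length v)) φa≡ φa-alternates))

  square-occurs : Unimodular A → ∃[ c ] ∃[ k ] OccursAt (c ∷ c ∷ []) w k
  square-occurs unimodular with square-or-alternating (w 0) (factorAt w 1 window)
  ... | inj₁ (y , c , v , e) = c , length y , isPrefix⇒occursAt y (isPrefix-++⁻ˡ (y ++ c ∷ c ∷ [])
        (subst IsPrefix (trans e (sym (List.++-assoc y (c ∷ c ∷ []) v))) (isPrefix-prefix (suc window))))
  ... | inj₂ e = ⊥-elim (¬alternates unimodular
        (subst (λ c → prefix w (suc window) ≡ iterate other c (suc window)) w0≡a
               (trans e (cong (λ n → iterate other (w 0) (suc n)) (length-factorAt 1 window)))))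

  module Residues (m : ℕ) .{{_ : NonZero m}} where

    open Congruence m

    -- OccursAfter u z says that z, read modulo m, belongs to the set X_{u,m} of the statement.
    OccursAfter : List Letter → Vector → Set
    OccursAfter u z = ∃[ y ] IsPrefix (y ++ u) × parikh y ≈ z

    Shiftable : Vector → Set
    Shiftable z = ∀ {P} → IsPrefix P → OccursAfter P z

    occursAt⇒occursAfter : ∀ {u i} → OccursAt u w i → OccursAfter u (parikh (prefix w i))
    occursAt⇒occursAfter occ = _ , occursAt⇒isPrefix occ , ≈-refl

    occursAfter⇒occursAt : ∀ {u z} → OccursAfter u z → ∃[ p ] OccursAt u w p × parikh (prefix w p) ≈ z
    occursAfter⇒occursAt (y , p , e) =
      length y , isPrefix⇒occursAt y p , ≈-trans (≈-reflexive (λ c → cong (count c) (isPrefix-++⁻ˡ y p))) e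

    occursAfter-≈ : ∀ {u z z′} → OccursAfter u z → z ≈ z′ → OccursAfter u z′
    occursAfter-≈ (y , p , e) e′ = y , p , ≈-trans e e′

    occursAfter-++⁻ˡ : ∀ u {v z} → OccursAfter (u ++ v) z → OccursAfter u z
    occursAfter-++⁻ˡ u {v} (y , p , e) = y , isPrefix-++⁻ˡ (y ++ u) (subst IsPrefix (sym (List.++-assoc y u v)) p) , e

    occursAfter-++⁻ʳ : ∀ x {u z} → OccursAfter (x ++ u) z → OccursAfter u (z ⊕ parikh x)
    occursAfter-++⁻ʳ x {u} (y , p , e) =
      y ++ x , subst IsPrefix (sym (List.++-assoc y x u)) p , ≈-trans (≈-reflexive (parikh-++ y x)) (⊕-cong e ≈-refl)

    occursAfter-iter : ∀ n {u z} → OccursAfter u z → OccursAfter (iter φ n u) (A ^ n · z)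
    occursAfter-iter n {u} (y , p , e) =
      iter φ n y , subst IsPrefix (iter-++ φ n y u) (isPrefix-iter n p) ,
      ≈-trans (≈-reflexive (parikh-iter φ n y)) (^·-cong A n e)

    occursAfter-pair : ∀ {c d t} → OccursAfter (c ∷ d ∷ []) t →
                       OccursAfter (c ∷ []) t × OccursAfter (d ∷ []) (t ⊕ unit c)
    occursAfter-pair {c} r = occursAfter-++⁻ˡ (c ∷ []) r , occursAfter-++⁻ʳ (c ∷ []) r

    shiftable-≈ : ∀ {z z′} → Shiftable z → z ≈ z′ → Shiftable z′
    shiftable-≈ sz e pP = occursAfter-≈ (sz pP) e

    shiftable-⊕ : ∀ {z z′} → Shiftable z → Shiftable z′ → Shiftable (z ⊕ z′)
    shiftable-⊕ sz sz′ pP with sz′ pP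
    ... | y , p , e = occursAfter-≈ (occursAfter-++⁻ʳ y (sz p)) (⊕-cong ≈-refl e)

    shiftable-⊙ : ∀ k {z} → Shiftable z → Shiftable (k ⊙ z)
    shiftable-⊙ zero    sz pP = [] , pP , λ c → ≋-refl
    shiftable-⊙ (suc k) sz    = shiftable-⊕ sz (shiftable-⊙ k sz)

    shiftable-cancel : ∀ {t d} → Shiftable t → Shiftable (t ⊕ d) → Shiftable d
    shiftable-cancel {t} {d} st std = shiftable-≈ (shiftable-⊕ std (shiftable-⊙ (pred m) st))
      λ c → ≋-trans (≋-reflexive (cong (_+ pred m * t c) (ℕ.+-comm (t c) (d c)))) (+-inverse (d c) (t c))

    shiftable-all : (∀ c → Shiftable (unit c)) → ∀ z → Shiftable z
    shiftable-all shiftable-unit z =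
      shiftable-≈ (shiftable-⊕ (shiftable-⊙ (z l0) (shiftable-unit l0)) (shiftable-⊙ (z l1) (shiftable-unit l1)))
                  (≈-sym (≈-reflexive (unit-decomposition z)))

    occursAfter-all : (∀ z → Shiftable z) → ∀ {u i} → OccursAt u w i → ∀ z → OccursAfter u z
    occursAfter-all shiftable {u} {i} occ z = occursAfter-≈
      (occursAfter-++⁻ʳ (prefix w i) (shiftable (z ⊕ pred m ⊙ v) (occursAt⇒isPrefix occ)))
      (λ c → ≋-trans (≋-reflexive (swap (z c) (v c) (pred m * v c))) (+-inverse (z c) (v c)))
      where
      v = parikh (prefix w i)
      swap : ∀ x k l → x + l + k ≡ x + k + l
      swap = solve-∀

    module Periodic (N : ℕ) (period : ∀ z → A ^ suc N · z ≈ z) where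

      period-multiple : ∀ k z → A ^ (k * suc N) · z ≈ z
      period-multiple zero    z = ≈-refl
      period-multiple (suc k) z = ≈-trans (≈-reflexive (^·-+ A (suc N) (k * suc N) z))
                                          (≈-trans (period _) (period-multiple k z))

      shiftable-a : ∀ {t} → OccursAfter (a ∷ []) t → Shiftable t
      shiftable-a {t} r {P} pP with iter-a-extends (length P * suc N) pP (ℕ.m≤m*n (length P) (suc N))
      ... | _ , e = occursAfter-++⁻ˡ P (subst (λ u → OccursAfter u t) e
                      (occursAfter-≈ (occursAfter-iter (length P * suc N) r) (period-multiple (length P) t)))

      module _ {y₁ y₂} (φb≡ : φ b ≡ y₁ ++ a ∷ y₂) where

        offset : Vector
        offset = A ^ N · parikh y₁

        shiftable-b : ∀ {t} → OccursAfter (b ∷ []) t → Shiftable (t ⊕ offset)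
        shiftable-b {t} r with a-in-iter-b φb≡ N
        ... | _ , e = shiftable-a (occursAfter-≈
          (occursAfter-++⁻ˡ (a ∷ []) (occursAfter-++⁻ʳ (iter φ N y₁)
            (subst (λ u → OccursAfter u t) e (occursAfter-≈ (occursAfter-iter (suc N) r) (period t)))))
          (⊕-cong ≈-refl (≈-reflexive (parikh-iter φ N y₁))))

        shiftable-a⊕offset : ∀ {t} → OccursAfter (a ∷ b ∷ []) t → Shiftable (unit a ⊕ offset)
        shiftable-a⊕offset r with occursAfter-pair r
        ... | ra , rb = shiftable-cancel (shiftable-a ra)
          (shiftable-≈ (shiftable-b rb) (λ c → ≋-reflexive (ℕ.+-assoc _ (unit a c) (offset c))))

        shiftable-a⊕b : ∀ {t} → Shiftable (unit a ⊕ offset) → OccursAfter (b ∷ a ∷ []) t →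
                        Shiftable (unit a ⊕ unit b)
        shiftable-a⊕b {t} sa⊕offset r with occursAfter-pair r
        ... | rb , ra = shiftable-cancel (shiftable-b rb)
          (shiftable-≈ (shiftable-⊕ (shiftable-a ra) sa⊕offset)
                       (λ c → ≋-reflexive (exchange (t c) (unit b c) (unit a c) (offset c))))
          where
          exchange : ∀ p q r s → p + q + (r + s) ≡ p + s + (r + q)
          exchange = solve-∀

        shiftable-aa : ∀ {t} → OccursAfter (a ∷ a ∷ []) t → Shiftable (unit a)
        shiftable-aa r with occursAfter-pair r
        ... | ra , ra′ = shiftable-cancel (shiftable-a ra) (shiftable-a ra′)

        shiftable-bb : ∀ {t} → OccursAfter (b ∷ b ∷ []) t → Shiftable (unit b)
        shiftable-bb {t} r with occursAfter-pair r
        ... | rb , rb′ = shiftable-cancel (shiftable-b rb)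
          (shiftable-≈ (shiftable-b rb′) (λ c → ≋-reflexive (exchange (t c) (unit b c) (offset c))))
          where
          exchange : ∀ p q r → p + q + r ≡ p + r + q
          exchange = solve-∀

        shiftable-units : ∀ {t₁ t₂ t₃ c} → OccursAfter (a ∷ b ∷ []) t₁ → OccursAfter (b ∷ a ∷ []) t₂ →
                          OccursAfter (c ∷ c ∷ []) t₃ → ∀ d → Shiftable (unit d)
        shiftable-units {c = c} rab rba rcc d with ≡-or-≡other a c | ≡-or-≡other a d
        ... | inj₁ refl | inj₁ refl = shiftable-aa rcc
        ... | inj₁ refl | inj₂ refl = shiftable-cancel (shiftable-aa rcc) (shiftable-a⊕b (shiftable-a⊕offset rab) rba)
        ... | inj₂ refl | inj₁ refl = shiftable-cancel (shiftable-bb rcc)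
          (shiftable-≈ (shiftable-a⊕b (shiftable-a⊕offset rab) rba) (λ c → ≋-reflexive (ℕ.+-comm (unit a c) (unit b c))))
        ... | inj₂ refl | inj₂ refl = shiftable-bb rcc

  every-residue-occurs : Binary w → Recurrent w → Unimodular A → ∀ m .{{_ : NonZero m}} → ∀ {u i} → OccursAt u w i →
                         ∀ z → ∃[ p ] OccursAt u w p × Congruence._≈_ m (parikh (prefix w p)) z
  every-residue-occurs binary recurrent unimodular m occ z =
    let N , period  = finite-order unimodular
        _ , _ , φb≡ = a-in-φb recurrent unimodular
        _ , ab      = ab-occurs binary
        _ , ba      = ba-occurs binary recurrent
        _ , _ , cc  = square-occurs unimodular
        shiftable-unit = Periodic.shiftable-units N period φb≡
          (occursAt⇒occursAfter ab) (occursAt⇒occursAfter ba) (occursAt⇒occursAfter cc)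
    in occursAfter⇒occursAt (occursAfter-all (shiftable-all shiftable-unit) occ z)
    where
    open Residues m
    open Congruence m using (finite-order)

theorem4 : (φ : Morphism) (w : InfWord) → Nonerasing φ → GeneratedBy φ w → Binary w → Recurrent w → (detA φ ≡ + 1 ⊎ detA φ ≡ - (+ 1)) → WELLDOC w
theorem4 φ w nonerasing (a , s , φa≡ , s≢[] , generated) binary recurrent det m u (i , occ) x y =
  let p , occ′ , p≈xy = Generated.every-residue-occurs φ w nonerasing a s φa≡ s≢[] generated
                          binary recurrent (unimodular-parikhMatrix φ det) m occ (vector x y)
  in p , occ′ , %-≡ (p≈xy l0) , %-≡ (p≈xy l1)
  where open Congruence m using (%-≡)
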